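{- Let $p$ be a prime number. Then there are at most $(p-1)/2$ pairs $(q,\ell)$, with $q$ a prime power and $\ell\geq 2$ an integer, such that $p=(q^\ell-1)/(q-1)$. -}

module Defs where

open import Data.Nat using (ℕ; _^_; _≤_; _*_; _∸_; _/_)
open import Data.Nat.Primality using (Prime)
open import Data.Product using (∃₂; _×_; _,_)
open import Relation.Binary.PropositionalEquality using (_≡_)

IsPrimePower : ℕ → Set
IsPrimePower q = ∃₂ λ r k → Prime r × 1 ≤ k × q ≡ r ^ k

-- Since q ≥ 2, (q - 1) divides q^ℓ - 1 and
-- the quotient equation is stated as the exact-division equation
-- p * (q - 1) = q^ℓ - 1 (truncated subtraction is exact as q ≥ 2, q^ℓ ≥ 1).
IsSolution : ℕ → ℕ × ℕ → Set
IsSolution p (q , ℓ) = IsPrimePower q × 2 ≤ ℓ × p * (q ∸ 1) ≡ q ^ ℓ ∸ 1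

module Submission where

-- Write R(q, ℓ) = 1 + q + … + q^(ℓ-1) for the base-q repunit of length ℓ.
-- Since (q - 1) R(q, ℓ) = q^ℓ - 1 and q ≥ 2, a solution means p = R(q, ℓ).
-- There are two regimes:  ℓ = 2, where p = 1 + q, and ℓ ≥ 3, where
-- p ≥ 1 + q + q² ≥ 1 + 2q, so that q ≤ (p - 1)/2.  We encode a solution
-- (q , ℓ) by the number 0 if ℓ = 2 and by q - 1 if ℓ ≥ 3.  This code is
-- below (p - 1)/2 in both regimes, and it is injective on solutions: the
-- code recovers q (there is only one candidate q with ℓ = 2), and q
-- recovers ℓ because q ^ ℓ is strictly increasing in ℓ.  A duplicate-free
-- list whose elements inject into {0, …, N - 1} has length at most N,
-- which proves the theorem.

open import Defs
open import Data.Nat using (ℕ; _≤_; _∸_; _/_)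
open import Data.Nat.Primality using (Prime)
open import Data.Product using (_×_)
open import Data.List using (List; length)
open import Data.List.Relation.Unary.All using (All)
open import Data.List.Relation.Unary.Unique.Propositional using (Unique)

open import Data.Nat using (zero; suc; _+_; _*_; _^_; _<_; s≤s; z≤n; NonZero; nonTrivial⇒n>1)
open import Data.Nat.Properties
open import Data.Nat.DivMod using (m*n/n≡m; /-monoˡ-≤)
open import Data.Nat.Primality using (prime⇒nonTrivial; prime⇒nonZero)
open import Data.Nat.Solver using (module +-*-Solver)
open import Data.Fin using (Fin; fromℕ<)
import Data.Fin as Fin
open import Data.Fin.Properties using (fromℕ<-injective; injective⇒≤)
open import Data.Product using (_,_)
open import Data.List using (lookup)
open import Data.List.Membership.Propositional.Properties using (∈-lookup)
open import Data.List.Relation.Unary.AllPairs using (_∷_)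
import Data.List.Relation.Unary.All as All
open import Function.Definitions using (Injective)
open import Relation.Binary using (tri<; tri≈; tri>)
open import Relation.Binary.PropositionalEquality
open import Relation.Nullary using (contradiction)

unique-lookup-injective : ∀ {A : Set} {xs : List A} → Unique xs →
                          ∀ i j → lookup xs i ≡ lookup xs j → i ≡ j
unique-lookup-injective (_ ∷ _) Fin.zero Fin.zero _ = refl
unique-lookup-injective (x∉ ∷ _) Fin.zero (Fin.suc j) eq =
  contradiction eq (All.lookup x∉ (∈-lookup j))
unique-lookup-injective (x∉ ∷ _) (Fin.suc i) Fin.zero eq =
  contradiction (sym eq) (All.lookup x∉ (∈-lookup i))
unique-lookup-injective (_ ∷ u) (Fin.suc i) (Fin.suc j) eq =
  cong Fin.suc (unique-lookup-injective u i j eq)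

length-≤-by-injection : ∀ {A : Set} {P : A → Set} {N : ℕ} {xs : List A} (f : A → ℕ) →
                        (∀ {x y} → P x → P y → f x ≡ f y → x ≡ y) →
                        (∀ {x} → P x → f x < N) →
                        Unique xs → All P xs → length xs ≤ N
length-≤-by-injection {P = P} {N} {xs} f f-injective f-bounded unique all-P =
  injective⇒≤ position-code-injective
  where
  P-at : ∀ i → P (lookup xs i)
  P-at i = All.lookup all-P (∈-lookup i)

  position-code : Fin (length xs) → Fin N
  position-code i = fromℕ< (f-bounded (P-at i))

  position-code-injective : Injective _≡_ _≡_ position-code
  position-code-injective {i} {j} eq =
    unique-lookup-injective unique i j
      (f-injective (P-at i) (P-at j) (fromℕ<-injective _ _ _ _ eq))

prime-power-≥2 : ∀ {q} → IsPrimePower q → 2 ≤ q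
prime-power-≥2 (r , suc k , r-prime , _ , refl) = begin
  2          ≤⟨ nonTrivial⇒n>1 r {{prime⇒nonTrivial r-prime}} ⟩
  r          ≤⟨ m≤m*n r (r ^ k) {{m^n≢0 r k {{prime⇒nonZero r-prime}}}} ⟩
  r * r ^ k  ∎
  where open ≤-Reasoning

^-injectiveʳ : ∀ m → 1 < m → ∀ {ℓ ℓ′} → m ^ ℓ ≡ m ^ ℓ′ → ℓ ≡ ℓ′
^-injectiveʳ m 1<m {ℓ} {ℓ′} eq with <-cmp ℓ ℓ′
... | tri< ℓ<ℓ′ _ _ = contradiction eq (<⇒≢ (^-monoʳ-< m 1<m ℓ<ℓ′))
... | tri≈ _ ℓ≡ℓ′ _ = ℓ≡ℓ′
... | tri> _ _ ℓ′<ℓ = contradiction (sym eq) (<⇒≢ (^-monoʳ-< m 1<m ℓ′<ℓ))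

repunit : ℕ → ℕ → ℕ
repunit q zero    = 0
repunit q (suc ℓ) = 1 + q * repunit q ℓ

repunit-geometric : ∀ m ℓ → m * repunit (suc m) ℓ + 1 ≡ suc m ^ ℓ
repunit-geometric m zero    = cong (_+ 1) (*-zeroʳ m)
repunit-geometric m (suc ℓ) = begin
  m * (1 + suc m * R) + 1  ≡⟨ expand m R ⟩
  suc m * (m * R + 1)      ≡⟨ cong (suc m *_) (repunit-geometric m ℓ) ⟩
  suc m * suc m ^ ℓ        ∎
  where
  open ≡-Reasoning
  open +-*-Solver
  R : ℕ
  R = repunit (suc m) ℓ
  expand : ∀ m R → m * (1 + suc m * R) + 1 ≡ suc m * (m * R + 1)
  expand = solve 2 (λ m R → m :* (con 1 :+ (con 1 :+ m) :* R) :+ con 1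
                          := (con 1 :+ m) :* (m :* R :+ con 1)) refl

repunit-two : ∀ q → repunit q 2 ≡ 1 + q
repunit-two q = cong suc (trans (cong (λ r → q * suc r) (*-zeroʳ q)) (*-identityʳ q))

-- From length 3 on, repunit q ℓ ≥ 1 + q + q² ≥ 1 + 2q  (for q ≥ 1).
repunit-long : ∀ {q} k → 1 ≤ q → 1 + q * 2 ≤ repunit q (3 + k)
repunit-long {q} k 1≤q = s≤s (*-monoʳ-≤ q (s≤s (*-mono-≤ 1≤q (s≤s z≤n))))

quotient-is-repunit : ∀ p m ℓ .{{_ : NonZero m}} →
                      p * m ≡ suc m ^ ℓ ∸ 1 → p ≡ repunit (suc m) ℓ
quotient-is-repunit p m ℓ eq = *-cancelʳ-≡ p R m (begin
  p * m              ≡⟨ eq ⟩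
  suc m ^ ℓ ∸ 1      ≡⟨ cong (_∸ 1) (sym (repunit-geometric m ℓ)) ⟩
  m * R + 1 ∸ 1      ≡⟨ m+n∸n≡m (m * R) 1 ⟩
  m * R              ≡⟨ *-comm m R ⟩
  R * m              ∎)
  where
  open ≡-Reasoning
  R : ℕ
  R = repunit (suc m) ℓ

half-bound : ∀ {q p} → 1 + q * 2 ≤ p → q ≤ (p ∸ 1) / 2
half-bound {q} (s≤s {n = p′} 2q≤p′) = begin
  q          ≡⟨ sym (m*n/n≡m q 2) ⟩
  q * 2 / 2  ≤⟨ /-monoˡ-≤ 2 2q≤p′ ⟩
  p′ / 2     ∎
  where open ≤-Reasoning

data Regime (p q : ℕ) : ℕ → Set where
  square : p ≡ 1 + q → Regime p q 2
  long   : ∀ {k} → 1 + q * 2 ≤ p → Regime p q (3 + k)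

repunit-regime : ∀ {p q ℓ} → 1 ≤ q → 2 ≤ ℓ → p ≡ repunit q ℓ → Regime p q ℓ
repunit-regime {q = q} {ℓ = 2}           _   _ refl = square (repunit-two q)
repunit-regime {ℓ = suc (suc (suc k))}   1≤q _ refl = long (repunit-long k 1≤q)
repunit-regime {ℓ = 1}                   _ (s≤s ()) _

solution-is-repunit : ∀ {p q ℓ} → IsSolution p (q , ℓ) → p ≡ repunit q ℓ
solution-is-repunit {p} {ℓ = ℓ} (q-pp , _ , eq) with prime-power-≥2 q-pp
... | s≤s (s≤s {n = s} _) = quotient-is-repunit p (suc s) ℓ eq

solution-regime : ∀ {p q ℓ} → IsSolution p (q , ℓ) → Regime p q ℓ
solution-regime {p} sol@(q-pp , 2≤ℓ , _) =
  repunit-regime (≤-trans (s≤s z≤n) (prime-power-≥2 q-pp)) 2≤ℓ (solution-is-repunit {p} sol)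

exponent-determined : ∀ {p q ℓ ℓ′} → IsSolution p (q , ℓ) → IsSolution p (q , ℓ′) → ℓ ≡ ℓ′
exponent-determined {q = q} {ℓ} {ℓ′} (q-pp , _ , eq) (_ , _ , eq′) with prime-power-≥2 q-pp
... | 2≤q@(s≤s (s≤s _)) =
  ^-injectiveʳ q 2≤q (∸-cancelʳ-≡ (m^n>0 q ℓ) (m^n>0 q ℓ′) (trans (sym eq) eq′))

solution-code : ℕ × ℕ → ℕ
solution-code (q , 2) = 0
solution-code (q , ℓ) = q ∸ 1

-- Codes of solutions lie below (p - 1)/2: in the regime ℓ = 2 we have
-- p = 1 + q ≥ 3, and otherwise q ≤ (p - 1)/2.
solution-code-bound : ∀ {p x} → IsSolution p x → solution-code x < (p ∸ 1) / 2
solution-code-bound {p} sol@(q-pp , _) with prime-power-≥2 q-pp | solution-regime {p} sol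
... | 2≤q         | square p≡1+q = half-bound (≤-trans (s≤s 2≤q) (≤-reflexive (sym p≡1+q)))
... | s≤s (s≤s _) | long 2q<p    = half-bound 2q<p

solution-code-base : ∀ {p q ℓ q′ ℓ′} → IsSolution p (q , ℓ) → IsSolution p (q′ , ℓ′) →
                     solution-code (q , ℓ) ≡ solution-code (q′ , ℓ′) → q ≡ q′
solution-code-base {p} sol@(q-pp , _) sol′@(q′-pp , _) eq
  with prime-power-≥2 q-pp | prime-power-≥2 q′-pp | solution-regime {p} sol | solution-regime {p} sol′
... | _           | _           | square p≡1+q | square p≡1+q′ = suc-injective (trans (sym p≡1+q) p≡1+q′)
... | _           | s≤s (s≤s _) | square _     | long _        with () ← eq
... | s≤s (s≤s _) | _           | long _       | square _      with () ← eq
... | s≤s (s≤s _) | s≤s (s≤s _) | long _       | long _        = cong suc eq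

solution-code-injective : ∀ {p x y} → IsSolution p x → IsSolution p y →
                          solution-code x ≡ solution-code y → x ≡ y
solution-code-injective {p} {x = q , _} sol sol′ eq with solution-code-base {p} sol sol′ eq
... | refl = cong (q ,_) (exponent-determined {p} sol sol′)

lemma7p1 : (p : ℕ) → Prime p → (sols : List (ℕ × ℕ)) → Unique sols → All (IsSolution p) sols → length sols ≤ (p ∸ 1) / 2
lemma7p1 p _ sols =
  length-≤-by-injection solution-code (solution-code-injective {p}) (solution-code-bound {p})
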